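{- Let $G=(V,E)$ be a cubic graph and $f:V\to\{ -1,1,2,3\}$. Then $f$ is a signed double Roman domination function on $G$ if and only if $f$ satisfies: (1) every $u\in V_{ -1}$ has a neighbor in $V_3$ or at least two distinct neighbors in $V_2$; (2) every $u\in V_1$ has a neighbor in $V_2\cup V_3$; and (3') for every $v\in V$ there exist distinct $v_1,v_2\in N[v]$ with $f(v_1)\neq -1$ and $f(v_2)\neq -1$.
   Context: All graphs are finite, undirected and simple; a cubic graph is a 3-regular graph. $N(u)$ is the open neighborhood of $u$ and $N[u]=N(u)\cup\{u\}$. For $f:V\to\{ -1,1,2,3\}$ write $V_i=f^{ -1}(i)$ and $f(S)=\sum_{s\in S}f(s)$. A function $f:V\to\{ -1,1,2,3\}$ is a signed double Roman domination function if: (1) every $u\in V_{ -1}$ has a neighbor in $V_3$ or at least two distinct neighbors in $V_2$; (2) every $u\in V_1$ has a neighbor in $V_2\cup V_3$; (3) $f(N[u])\ge 1$ for all $u\in V$. -}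

module Defs where

open import Data.Nat using (ℕ)
open import Data.Integer using (ℤ; +_; -[1+_]; _+_; _≤_)
open import Data.Fin using (Fin)
open import Data.List using (List; map; allFin; foldr)
open import Data.Nat.ListAction using (sum)
open import Data.Bool using (Bool; true; false; if_then_else_)
open import Data.Product using (Σ; ∃; _×_; _,_)
open import Data.Sum using (_⊎_)
open import Relation.Binary.PropositionalEquality using (_≡_; _≢_)

record Graph : Set where
  field
    n     : ℕ
    adj   : Fin n → Fin n → Bool
    sym   : ∀ u v → adj u v ≡ adj v u
    irrefl : ∀ u → adj u u ≡ false
open Graph public

Vertex : Graph → Set
Vertex G = Fin (n G)

Adj : (G : Graph) → Vertex G → Vertex G → Set
Adj G u w = adj G u w ≡ true

degree : (G : Graph) → Vertex G → ℕ
degree G u = sum (map (λ w → if adj G u w then 1 else 0) (allFin (n G)))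

Cubic : Graph → Set
Cubic G = ∀ u → degree G u ≡ 3

data Label : Set where
  m1 one two three : Label

val : Label → ℤ
val m1    = -[1+ 0 ]
val one   = + 1
val two   = + 2
val three = + 3

sumClosedNbhd : (G : Graph) → (Vertex G → Label) → Vertex G → ℤ
sumClosedNbhd G f u =
  val (f u) + foldr _+_ (+ 0)
    (map (λ w → if adj G u w then val (f w) else + 0) (allFin (n G)))

InClosedNbhd : (G : Graph) → Vertex G → Vertex G → Set
InClosedNbhd G v w = w ≡ v ⊎ Adj G v w

Cond1 : (G : Graph) → (Vertex G → Label) → Set
Cond1 G f = ∀ u → f u ≡ m1 →
  (∃ λ w → Adj G u w × f w ≡ three)
  ⊎ (Σ (Vertex G) λ w₁ → Σ (Vertex G) λ w₂ →
       w₁ ≢ w₂ × Adj G u w₁ × Adj G u w₂ × f w₁ ≡ two × f w₂ ≡ two)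

Cond2 : (G : Graph) → (Vertex G → Label) → Set
Cond2 G f = ∀ u → f u ≡ one →
  ∃ λ w → Adj G u w × (f w ≡ two ⊎ f w ≡ three)

Cond3 : (G : Graph) → (Vertex G → Label) → Set
Cond3 G f = ∀ u → + 1 ≤ sumClosedNbhd G f u

Cond3' : (G : Graph) → (Vertex G → Label) → Set
Cond3' G f = ∀ v → Σ (Vertex G) λ v₁ → Σ (Vertex G) λ v₂ →
  v₁ ≢ v₂ × InClosedNbhd G v v₁ × InClosedNbhd G v v₂ × f v₁ ≢ m1 × f v₂ ≢ m1

IsSDRDF : (G : Graph) → (Vertex G → Label) → Set
IsSDRDF G f = Cond1 G f × Cond2 G f × Cond3 G f

{-# OPTIONS --safe #-}
-- Give each label the weight f(w) + 1, which is 0 on V₋₁ and lies in {2, 3, 4} elsewhere.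
-- Since every vertex has exactly three neighbours, f(N[u]) + 4 is the total weight of N[u],
-- so condition (3) at u says that N[u] has weight at least 5.  If f(u) ≠ −1 this holds as soon
-- as one neighbour lies outside V₋₁ (given (2) when f(u) = 1), and fails otherwise because a
-- single weight is at most 4.  If f(u) = −1 it needs two neighbours outside V₋₁, and (1)
-- together with (3') supplies either two neighbours of weight 3 or one of weight 4 and
-- another of weight at least 2.
module Submission where

open import Defs hiding (sym)
open import Data.Product using (_×_; Σ; ∃; ∃₂; _,_)
open import Function.Bundles using (_⇔_; mk⇔; Equivalence)

open import Data.Bool using (true; false; if_then_else_)
open import Data.Empty using (⊥-elim)
open import Data.Fin using (_≟_)
open import Data.Integer as ℤ using (ℤ; +_; +≤+)
import Data.Integer.Properties as ℤP
open import Algebra.Properties.CommutativeSemigroup ℤP.+-commutativeSemigroup using (interchange)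
open import Data.List using ([]; _∷_; map; allFin; foldr)
open import Data.List.Membership.Propositional using (_∈_)
open import Data.List.Membership.Propositional.Properties using (∈-allFin)
open import Data.List.Relation.Unary.All using () renaming (lookup to All-lookup)
open import Data.List.Relation.Unary.Any using (here; there)
open import Data.List.Relation.Unary.AllPairs using (_∷_)
open import Data.List.Relation.Unary.Unique.Propositional using (Unique)
open import Data.List.Relation.Unary.Unique.Propositional.Properties using (allFin⁺)
open import Data.Nat as ℕ using (ℕ; zero; suc; _≤_; _<_; z≤n; s≤s)
import Data.Nat.Properties as ℕP
open import Data.Nat.ListAction using (sum)
open import Data.Sum using (_⊎_; inj₁; inj₂)
open import Relation.Nullary using (yes; no)
open import Relation.Binary.PropositionalEquality
  using (_≡_; _≢_; refl; sym; trans; cong; cong₂; subst; subst₂; module ≡-Reasoning)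

m≤n<m+o⇒0<o : ∀ {m n o} → m ≤ n → n < m ℕ.+ o → 0 < o
m≤n<m+o⇒0<o {m} m≤n n<m+o =
  ℕP.+-cancelˡ-< m 0 _ (ℕP.≤-<-trans (ℕP.≤-trans (ℕP.≤-reflexive (ℕP.+-identityʳ m)) m≤n) n<m+o)

module _ {a} {A : Set a} (g : A → ℕ) where

  ∈⇒≤sum : ∀ {x xs} → x ∈ xs → g x ≤ sum (map g xs)
  ∈⇒≤sum {xs = y ∷ ys} (here refl)  = ℕP.m≤m+n (g y) (sum (map g ys))
  ∈⇒≤sum {xs = y ∷ ys} (there x∈ys) = ℕP.≤-trans (∈⇒≤sum x∈ys) (ℕP.m≤n+m _ (g y))

  ∈-distinct⇒+≤sum : ∀ {x y xs} → x ≢ y → x ∈ xs → y ∈ xs → g x ℕ.+ g y ≤ sum (map g xs)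
  ∈-distinct⇒+≤sum x≢y (here refl) (here refl) = ⊥-elim (x≢y refl)
  ∈-distinct⇒+≤sum x≢y (here refl) (there y∈zs) = ℕP.+-monoʳ-≤ _ (∈⇒≤sum y∈zs)
  ∈-distinct⇒+≤sum {x} {y} x≢y (there x∈zs) (here refl) =
    ℕP.≤-trans (ℕP.≤-reflexive (ℕP.+-comm (g x) (g y))) (ℕP.+-monoʳ-≤ (g y) (∈⇒≤sum x∈zs))
  ∈-distinct⇒+≤sum {xs = z ∷ _} x≢y (there x∈zs) (there y∈zs) =
    ℕP.≤-trans (∈-distinct⇒+≤sum x≢y x∈zs y∈zs) (ℕP.m≤n+m _ (g z))

  0<sum⇒∃≢0 : ∀ xs → 0 < sum (map g xs) → ∃ λ x → x ∈ xs × g x ≢ 0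
  0<sum⇒∃≢0 (x ∷ xs) 0<sum with g x in gx≡
  ... | zero  = let y , y∈xs , gy≢0 = 0<sum⇒∃≢0 xs 0<sum in y , there y∈xs , gy≢0
  ... | suc _ = x , here refl , λ gx≡0 → ℕP.0≢1+n (trans (sym gx≡0) gx≡)

  bounded<sum⇒∃₂≢0 : ∀ {b} xs → Unique xs → (∀ x → g x ≤ b) → b < sum (map g xs) →
    ∃₂ λ x y → x ≢ y × x ∈ xs × y ∈ xs × g x ≢ 0 × g y ≢ 0
  bounded<sum⇒∃₂≢0 (x ∷ xs) (x∉xs ∷ unique) g≤b b<sum with g x in gx≡ | g≤b x
  ... | zero | _ =
    let y , z , y≢z , y∈xs , z∈xs , gy≢0 , gz≢0 = bounded<sum⇒∃₂≢0 xs unique g≤b b<sum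
    in  y , z , y≢z , there y∈xs , there z∈xs , gy≢0 , gz≢0
  ... | suc _ | gx≤b =
    let y , y∈xs , gy≢0 = 0<sum⇒∃≢0 xs (m≤n<m+o⇒0<o gx≤b b<sum)
    in  x , y , All-lookup x∉xs y∈xs , here refl , there y∈xs ,
        (λ gx≡0 → ℕP.0≢1+n (trans (sym gx≡0) gx≡)) , gy≢0

foldr+-map+sum≡sum : ∀ {a} {A : Set a} (h : A → ℤ) (c t : A → ℕ) →
  (∀ x → h x ℤ.+ + c x ≡ + t x) →
  ∀ xs → foldr ℤ._+_ (+ 0) (map h xs) ℤ.+ + sum (map c xs) ≡ + sum (map t xs)
foldr+-map+sum≡sum h c t h+c≡t [] = refl
foldr+-map+sum≡sum h c t h+c≡t (x ∷ xs) = begin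
  (h x ℤ.+ H) ℤ.+ + (c x ℕ.+ C)    ≡⟨ cong (λ z → (h x ℤ.+ H) ℤ.+ z) (ℤP.pos-+ (c x) C) ⟩
  (h x ℤ.+ H) ℤ.+ (+ c x ℤ.+ + C)  ≡⟨ interchange (h x) H (+ c x) (+ C) ⟩
  (h x ℤ.+ + c x) ℤ.+ (H ℤ.+ + C)  ≡⟨ cong₂ ℤ._+_ (h+c≡t x) (foldr+-map+sum≡sum h c t h+c≡t xs) ⟩
  + t x ℤ.+ + sum (map t xs)       ≡⟨ ℤP.pos-+ (t x) _ ⟨
  + sum (map t (x ∷ xs))           ∎
  where
  open ≡-Reasoning
  H = foldr ℤ._+_ (+ 0) (map h xs)
  C = sum (map c xs)

+-cancelʳ-≤ : ∀ i j k → i ℤ.+ k ℤ.≤ j ℤ.+ k → i ℤ.≤ j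
+-cancelʳ-≤ i j k i+k≤j+k =
  subst₂ ℤ._≤_ (i+k-k≡i i) (i+k-k≡i j) (ℤP.+-monoˡ-≤ (ℤ.- k) i+k≤j+k)
  where
  i+k-k≡i : ∀ i → i ℤ.+ k ℤ.- k ≡ i
  i+k-k≡i i = trans (ℤP.+-assoc i k (ℤ.- k))
                (trans (cong (λ z → i ℤ.+ z) (ℤP.+-inverseʳ k)) (ℤP.+-identityʳ i))

weight : Label → ℕ
weight m1    = 0
weight one   = 2
weight two   = 3
weight three = 4

+weight≡val+1 : ∀ l → + weight l ≡ val l ℤ.+ + 1
+weight≡val+1 m1    = refl
+weight≡val+1 one   = refl
+weight≡val+1 two   = refl
+weight≡val+1 three = refl

weight≤4 : ∀ l → weight l ≤ 4
weight≤4 m1    = z≤n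
weight≤4 one   = s≤s (s≤s z≤n)
weight≤4 two   = s≤s (s≤s (s≤s z≤n))
weight≤4 three = ℕP.≤-refl

2≤weight : ∀ {l} → l ≢ m1 → 2 ≤ weight l
2≤weight {m1}    l≢m1 = ⊥-elim (l≢m1 refl)
2≤weight {one}   _    = ℕP.≤-refl
2≤weight {two}   _    = s≤s (s≤s z≤n)
2≤weight {three} _    = s≤s (s≤s z≤n)

3≤weight : ∀ {l} → l ≡ two ⊎ l ≡ three → 3 ≤ weight l
3≤weight (inj₁ refl) = ℕP.≤-refl
3≤weight (inj₂ refl) = ℕP.n≤1+n 3

≡m1⊎≢m1 : ∀ l → l ≡ m1 ⊎ l ≢ m1
≡m1⊎≢m1 m1    = inj₁ refl
≡m1⊎≢m1 one   = inj₂ λ ()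
≡m1⊎≢m1 two   = inj₂ λ ()
≡m1⊎≢m1 three = inj₂ λ ()

adj⇒≢ : ∀ (G : Graph) {u w} → Adj G u w → u ≢ w
adj⇒≢ G {u} uw refl with trans (sym uw) (irrefl G u)
... | ()

Cond3At : (G : Graph) → (Vertex G → Label) → Vertex G → Set
Cond3At G f u = + 1 ℤ.≤ sumClosedNbhd G f u

Cond3'At : (G : Graph) → (Vertex G → Label) → Vertex G → Set
Cond3'At G f v = Σ (Vertex G) λ v₁ → Σ (Vertex G) λ v₂ →
  v₁ ≢ v₂ × InClosedNbhd G v v₁ × InClosedNbhd G v v₂ × f v₁ ≢ m1 × f v₂ ≢ m1

module _ (G : Graph) (f : Vertex G → Label) where

  neighbourWeight : Vertex G → Vertex G → ℕ
  neighbourWeight u w = if adj G u w then weight (f w) else 0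

  nbhdWeight : Vertex G → ℕ
  nbhdWeight u = sum (map (neighbourWeight u) (allFin (n G)))

  neighbourWeight-adj : ∀ {u w} → Adj G u w → neighbourWeight u w ≡ weight (f w)
  neighbourWeight-adj uw rewrite uw = refl

  neighbourWeight≤4 : ∀ u w → neighbourWeight u w ≤ 4
  neighbourWeight≤4 u w with adj G u w
  ... | false = z≤n
  ... | true  = weight≤4 (f w)

  neighbourWeight≢0⇒ : ∀ {u w} → neighbourWeight u w ≢ 0 → Adj G u w × f w ≢ m1
  neighbourWeight≢0⇒ {u} {w} weight≢0 with adj G u w
  ... | false = ⊥-elim (weight≢0 refl)
  ... | true  = refl , λ fw≡m1 → weight≢0 (cong weight fw≡m1)

  adj⇒weight≤nbhdWeight : ∀ {u w} → Adj G u w → weight (f w) ≤ nbhdWeight u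
  adj⇒weight≤nbhdWeight {u} {w} uw =
    subst (_≤ nbhdWeight u) (neighbourWeight-adj uw) (∈⇒≤sum (neighbourWeight u) (∈-allFin w))

  adj-distinct⇒weight+weight≤nbhdWeight : ∀ {u w₁ w₂} → w₁ ≢ w₂ → Adj G u w₁ → Adj G u w₂ →
    weight (f w₁) ℕ.+ weight (f w₂) ≤ nbhdWeight u
  adj-distinct⇒weight+weight≤nbhdWeight {u} {w₁} {w₂} w₁≢w₂ uw₁ uw₂ =
    subst (_≤ nbhdWeight u) (cong₂ ℕ._+_ (neighbourWeight-adj uw₁) (neighbourWeight-adj uw₂))
      (∈-distinct⇒+≤sum (neighbourWeight u) w₁≢w₂ (∈-allFin w₁) (∈-allFin w₂))

  sumClosedNbhd+4≡weight+nbhdWeight : Cubic G → ∀ u →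
    sumClosedNbhd G f u ℤ.+ + 4 ≡ + (weight (f u) ℕ.+ nbhdWeight u)
  sumClosedNbhd+4≡weight+nbhdWeight cubic u = begin
    (val (f u) ℤ.+ F) ℤ.+ (+ 1 ℤ.+ + 3)        ≡⟨ interchange (val (f u)) F (+ 1) (+ 3) ⟩
    (val (f u) ℤ.+ + 1) ℤ.+ (F ℤ.+ + 3)        ≡⟨ cong₂ ℤ._+_ (+weight≡val+1 (f u)) (sym F+3≡W) ⟨
    + weight (f u) ℤ.+ + nbhdWeight u ≡⟨ ℤP.pos-+ (weight (f u)) _ ⟨
    + (weight (f u) ℕ.+ nbhdWeight u) ∎
    where
    open ≡-Reasoning
    F = foldr ℤ._+_ (+ 0) (map (λ w → if adj G u w then val (f w) else + 0) (allFin (n G)))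

    term+indicator≡neighbourWeight : ∀ w →
      (if adj G u w then val (f w) else + 0) ℤ.+ + (if adj G u w then 1 else 0) ≡ + neighbourWeight u w
    term+indicator≡neighbourWeight w with adj G u w
    ... | false = refl
    ... | true  = sym (+weight≡val+1 (f w))

    F+3≡W : F ℤ.+ + 3 ≡ + nbhdWeight u
    F+3≡W = subst (λ d → F ℤ.+ + d ≡ + nbhdWeight u) (cubic u)
      (foldr+-map+sum≡sum _ _ _ term+indicator≡neighbourWeight (allFin (n G)))

  Cond3At⇔5≤weight+nbhdWeight : Cubic G → ∀ u →
    Cond3At G f u ⇔ 5 ≤ weight (f u) ℕ.+ nbhdWeight u
  Cond3At⇔5≤weight+nbhdWeight cubic u = mk⇔
    (λ 1≤sum → ℤP.drop‿+≤+ (subst (+ 5 ℤ.≤_) S+4≡W (ℤP.+-monoˡ-≤ (+ 4) 1≤sum)))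
    (λ 5≤W → +-cancelʳ-≤ (+ 1) _ (+ 4) (subst (+ 5 ℤ.≤_) (sym S+4≡W) (+≤+ 5≤W)))
    where
    S+4≡W = sumClosedNbhd+4≡weight+nbhdWeight cubic u

  5≤weight+nbhdWeight⇒Cond3'At : ∀ v → 5 ≤ weight (f v) ℕ.+ nbhdWeight v → Cond3'At G f v
  5≤weight+nbhdWeight⇒Cond3'At v 5≤W with ≡m1⊎≢m1 (f v)
  ... | inj₁ fv≡m1 =
    let 4<W = subst (λ l → 5 ≤ weight l ℕ.+ nbhdWeight v) fv≡m1 5≤W
        w₁ , w₂ , w₁≢w₂ , _ , _ , weight₁≢0 , weight₂≢0 =
          bounded<sum⇒∃₂≢0 (neighbourWeight v) (allFin (n G)) (allFin⁺ (n G)) (neighbourWeight≤4 v) 4<W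
        vw₁ , fw₁≢m1 = neighbourWeight≢0⇒ weight₁≢0
        vw₂ , fw₂≢m1 = neighbourWeight≢0⇒ weight₂≢0
    in  w₁ , w₂ , w₁≢w₂ , inj₂ vw₁ , inj₂ vw₂ , fw₁≢m1 , fw₂≢m1
  ... | inj₂ fv≢m1 =
    let w , _ , weight≢0 = 0<sum⇒∃≢0 (neighbourWeight v) (allFin (n G)) (m≤n<m+o⇒0<o (weight≤4 (f v)) 5≤W)
        vw , fw≢m1 = neighbourWeight≢0⇒ weight≢0
    in  v , w , adj⇒≢ G vw , inj₁ refl , inj₂ vw , fv≢m1 , fw≢m1

  Cond3'At⇒2≤nbhdWeight : ∀ {v} → Cond3'At G f v → 2 ≤ nbhdWeight v
  Cond3'At⇒2≤nbhdWeight (v₁ , _ , _ , inj₂ vv₁ , _ , fv₁≢m1 , _) =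
    ℕP.≤-trans (2≤weight fv₁≢m1) (adj⇒weight≤nbhdWeight vv₁)
  Cond3'At⇒2≤nbhdWeight (_ , v₂ , _ , inj₁ _ , inj₂ vv₂ , _ , fv₂≢m1) =
    ℕP.≤-trans (2≤weight fv₂≢m1) (adj⇒weight≤nbhdWeight vv₂)
  Cond3'At⇒2≤nbhdWeight (_ , _ , v₁≢v₂ , inj₁ refl , inj₁ refl , _ , _) = ⊥-elim (v₁≢v₂ refl)

  inClosedNbhd⇒adj : ∀ {v w} → f v ≡ m1 → InClosedNbhd G v w → f w ≢ m1 → Adj G v w
  inClosedNbhd⇒adj fv≡m1 (inj₁ refl) fw≢m1 = ⊥-elim (fw≢m1 fv≡m1)
  inClosedNbhd⇒adj _     (inj₂ vw)   _     = vw

  Cond3'At⇒adj-≢ : ∀ {v} → f v ≡ m1 → Cond3'At G f v → ∀ w → ∃ λ w′ → w′ ≢ w × Adj G v w′ × f w′ ≢ m1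
  Cond3'At⇒adj-≢ fv≡m1 (v₁ , v₂ , v₁≢v₂ , vv₁ , vv₂ , fv₁≢m1 , fv₂≢m1) w with v₁ ≟ w
  ... | yes refl = v₂ , (λ v₂≡v₁ → v₁≢v₂ (sym v₂≡v₁)) , inClosedNbhd⇒adj fv≡m1 vv₂ fv₂≢m1 , fv₂≢m1
  ... | no v₁≢w  = v₁ , v₁≢w , inClosedNbhd⇒adj fv≡m1 vv₁ fv₁≢m1 , fv₁≢m1

  Cond3'At⇒5≤weight+nbhdWeight : Cond1 G f → Cond2 G f →
    ∀ v → Cond3'At G f v → 5 ≤ weight (f v) ℕ.+ nbhdWeight v
  Cond3'At⇒5≤weight+nbhdWeight cond1 cond2 v cond3' with f v in fv≡
  ... | one with cond2 v fv≡
  ...   | w , vw , fw≡two⊎three =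
    ℕP.+-monoʳ-≤ 2 (ℕP.≤-trans (3≤weight fw≡two⊎three) (adj⇒weight≤nbhdWeight vw))
  Cond3'At⇒5≤weight+nbhdWeight cond1 cond2 v cond3' | two =
    ℕP.+-monoʳ-≤ 3 (Cond3'At⇒2≤nbhdWeight cond3')
  Cond3'At⇒5≤weight+nbhdWeight cond1 cond2 v cond3' | three =
    ℕP.≤-trans (ℕP.n≤1+n 5) (ℕP.+-monoʳ-≤ 4 (Cond3'At⇒2≤nbhdWeight cond3'))
  Cond3'At⇒5≤weight+nbhdWeight cond1 cond2 v cond3' | m1 with cond1 v fv≡
  ... | inj₁ (w , vw , fw≡three) =
    let w′ , w′≢w , vw′ , fw′≢m1 = Cond3'At⇒adj-≢ fv≡ cond3' w
    in  ℕP.≤-trans (ℕP.n≤1+n 5) (ℕP.≤-trans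
          (ℕP.+-mono-≤ (ℕP.≤-reflexive (cong weight (sym fw≡three))) (2≤weight fw′≢m1))
          (adj-distinct⇒weight+weight≤nbhdWeight (λ w≡w′ → w′≢w (sym w≡w′)) vw vw′))
  ... | inj₂ (w₁ , w₂ , w₁≢w₂ , vw₁ , vw₂ , fw₁≡two , fw₂≡two) =
    ℕP.≤-trans (ℕP.n≤1+n 5) (ℕP.≤-trans
      (ℕP.≤-reflexive (cong₂ ℕ._+_ (cong weight (sym fw₁≡two)) (cong weight (sym fw₂≡two))))
      (adj-distinct⇒weight+weight≤nbhdWeight w₁≢w₂ vw₁ vw₂))

mainTheorem2 : (G : Graph) → Cubic G → (f : Vertex G → Label) →
    IsSDRDF G f ⇔ (Cond1 G f × Cond2 G f × Cond3' G f)
mainTheorem2 G cubic f = mk⇔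
  (λ (cond1 , cond2 , cond3) → cond1 , cond2 , λ v →
     5≤weight+nbhdWeight⇒Cond3'At G f v (to (Cond3At⇔5≤weight+nbhdWeight G f cubic v) (cond3 v)))
  (λ (cond1 , cond2 , cond3') → cond1 , cond2 , λ v →
     from (Cond3At⇔5≤weight+nbhdWeight G f cubic v)
       (Cond3'At⇒5≤weight+nbhdWeight G f cond1 cond2 v (cond3' v)))
  where open Equivalence
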